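{- Let $p$ be a prime and $r\ge1$ an integer. If $f\in\mathbb{Q}[x]$ is a $p^r$-pure polynomial with $\deg f>1$, then the $n$-fold iterate $f^n=f\circ\cdots\circ f$ is $p^r$-pure for all $n\ge1$.
   Context: $\nu_p$ denotes the $p$-adic valuation on $\mathbb{Q}$ (with $\nu_p(0)=\infty$). A polynomial $q(x)=a_nx^n+\dots+a_0\in\mathbb{Q}[x]$ of degree $n$ is $p^r$-pure if $\nu_p(a_n)=0$, $\nu_p(a_0)=r$, and $\frac{\nu_p(a_i)}{n-i}\ge\frac{r}{n}$ for all $1\le i\le n-1$. -}

module Defs where

open import Data.Nat as ℕ using (ℕ; zero; suc; _^_; _<_; _≤_; _∸_)
open import Data.Nat.Divisibility using (_∣_)
open import Data.Integer as ℤ using (ℤ; +_; ∣_∣)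
open import Data.Rational as ℚ using (ℚ; 0ℚ; 1ℚ; ↥_; ↧ₙ_)
open import Data.List using (List; []; _∷_)
open import Data.Product using (Σ; _×_; ∃-syntax)
open import Data.Sum using (_⊎_)
open import Relation.Nullary using (¬_)
open import Relation.Binary.PropositionalEquality using (_≡_; _≢_)

-- Exact multiplicity of p in a natural number m: p^k ∣ m and p^(k+1) ∤ m.
-- (Unsatisfiable for m = 0.)
IsMult : ℕ → ℕ → ℕ → Set
IsMult p m k = (p ^ k ∣ m) × ¬ (p ^ suc k ∣ m)

-- ν_p(a) = v  for a rational a (in lowest terms).  Unsatisfiable for a = 0,
-- matching ν_p(0) = ∞.
Val : ℕ → ℚ → ℤ → Set
Val p a v = ∃[ k ] ∃[ l ] (IsMult p ∣ ↥ a ∣ k × IsMult p (↧ₙ a) l × v ≡ (+ k) ℤ.- (+ l))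

-- Polynomials in ℚ[x] as coefficient lists [a₀, a₁, …] (trailing zeros allowed).
Poly : Set
Poly = List ℚ

coeff : Poly → ℕ → ℚ
coeff []       _       = 0ℚ
coeff (a ∷ as) zero    = a
coeff (a ∷ as) (suc i) = coeff as i

_⊕_ : Poly → Poly → Poly
[]       ⊕ q        = q
(a ∷ as) ⊕ []       = a ∷ as
(a ∷ as) ⊕ (b ∷ bs) = (a ℚ.+ b) ∷ (as ⊕ bs)

scale : ℚ → Poly → Poly
scale c []       = []
scale c (a ∷ as) = (c ℚ.* a) ∷ scale c as

_⊗_ : Poly → Poly → Poly
[]       ⊗ q = []
(a ∷ as) ⊗ q = scale a q ⊕ (0ℚ ∷ (as ⊗ q))

compose : Poly → Poly → Poly
compose []       g = []
compose (a ∷ as) g = (a ∷ []) ⊕ (g ⊗ compose as g)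

iterate : Poly → ℕ → Poly
iterate f zero    = 0ℚ ∷ 1ℚ ∷ []
iterate f (suc n) = compose f (iterate f n)

Degree : Poly → ℕ → Set
Degree f n = (coeff f n ≢ 0ℚ) × (∀ j → n < j → coeff f j ≡ 0ℚ)

-- f of degree n is p^r-pure:
--   ν_p(a_n) = 0, ν_p(a_0) = r, and ν_p(a_i)/(n-i) ≥ r/n for 1 ≤ i ≤ n-1,
-- the last written as n·ν_p(a_i) ≥ r·(n-i) (trivially true when a_i = 0).
Pure : ℕ → ℕ → Poly → Set
Pure p r f = ∃[ n ] (Degree f n
  × Val p (coeff f n) (+ 0)
  × Val p (coeff f 0) (+ r)
  × (∀ i → 1 ≤ i → i < n →
       coeff f i ≡ 0ℚ
       ⊎ ∃[ v ] (Val p (coeff f i) v × (+ r) ℤ.* (+ (n ∸ i)) ℤ.≤ v ℤ.* (+ n))))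

module Submission where

-- Write ν for ν_p. A polynomial h = Σ aₖ xᵏ of degree N ≥ 1 with a unit leading coefficient satisfies
-- the p^r-purity inequalities iff its Newton polygon lies above the segment from (0, r) to (N, 0), i.e.
-- N·ν(aₖ) + r·k ≥ r·N for all k. Such weighted bounds add up under products and survive sums, so
-- evaluating f ∘ g by Horner's scheme, measuring ν with the weight d·m where d = deg f and m = deg g,
-- shows that f ∘ g again satisfies them, with degree d·m and unit leading coefficient. For the constant
-- term write f = a₀ + x·f₁: then (f ∘ g)(0) = a₀ + g(0)·f₁(g(0)), where ν(g(0)) ≥ r and the weighted
-- bound with d ≥ 2 gives ν(f₁(g(0))) ≥ 1, so ν((f ∘ g)(0)) = ν(a₀) = r. Induct from f⁰ = x.

open import Defs
open import Data.Nat as ℕ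
  using (ℕ; zero; suc; _+_; _*_; _∸_; _^_; _≤_; _<_; s≤s; z≤n; NonZero)
import Data.Nat.Properties as ℕₚ
open import Data.Nat.Divisibility as ℕ∣ using (_∣_; divides; _∣?_)
open import Data.Nat.Primality using (Prime; euclidsLemma; prime⇒nonZero; prime⇒nonTrivial)
import Data.Nat.Tactic.RingSolver as ℕ-Ring
open import Data.Integer as ℤ using (+_; -[1+_]; ∣_∣; sign; _◃_; +≤+; +0)
import Data.Integer.Properties as ℤₚ
import Data.Integer.Divisibility.Signed as ℤ∣
import Data.Integer.Tactic.RingSolver as ℤ-Ring
open import Data.Rational as ℚ using (ℚ; mkℚ; ↥_; ↧_; ↧ₙ_; toℚᵘ; 0ℚ; 1ℚ)
import Data.Rational.Properties as ℚₚ
open import Data.Rational.Unnormalised as ℚᵘ using (mkℚᵘ; *≡*; _≃_)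
import Data.Rational.Unnormalised.Properties as ℚᵘₚ
import Data.Sign as Sign
import Data.Sign.Properties as Signₚ
open import Data.List using ([]; _∷_)
open import Data.Product using (_×_; _,_; ∃-syntax; proj₁; proj₂)
open import Data.Sum using (_⊎_; inj₁; inj₂)
open import Data.Empty using (⊥-elim)
open import Relation.Nullary using (¬_; yes; no)
open import Relation.Binary.PropositionalEquality
open import Relation.Binary.Definitions using (tri<; tri≈; tri>)
open ≡-Reasoning

^-monoʳ-∣ : ∀ p {m n} → m ≤ n → p ^ m ∣ p ^ n
^-monoʳ-∣ p {m} {n} m≤n = divides (p ^ (n ∸ m)) (begin
  p ^ n             ≡⟨ cong (p ^_) (ℕₚ.m∸n+n≡m m≤n) ⟨
  p ^ (n ∸ m + m)   ≡⟨ ℕₚ.^-distribˡ-+-* p (n ∸ m) m ⟩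
  p ^ (n ∸ m) * p ^ m ∎)

IsMult-≤ : ∀ {p n k j} → IsMult p n k → p ^ j ∣ n → j ≤ k
IsMult-≤ {p} {n} {k} {j} (_ , p^1+k∤n) p^j∣n with j ℕ.≤? k
... | yes j≤k = j≤k
... | no  j≰k = ⊥-elim (p^1+k∤n (ℕ∣.∣-trans (^-monoʳ-∣ p (ℕₚ.≰⇒> j≰k)) p^j∣n))

IsMult-unique : ∀ {p n k j} → IsMult p n k → IsMult p n j → k ≡ j
IsMult-unique mk mj = ℕₚ.≤-antisym (IsMult-≤ mj (proj₁ mk)) (IsMult-≤ mk (proj₁ mj))

IsMult⇒nonZero : ∀ {p n k} → IsMult p n k → NonZero n
IsMult⇒nonZero {p} {zero}  {k} (_ , p^1+k∤0) = ⊥-elim (p^1+k∤0 (ℕ∣._∣0 (p ^ suc k)))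
IsMult⇒nonZero {p} {suc n} _                 = _

∣∣-+ : ∀ d {i j} → d ∣ ∣ i ∣ → d ∣ ∣ j ∣ → d ∣ ∣ i ℤ.+ j ∣
∣∣-+ d {i} {j} d∣i d∣j =
  ℤ∣.∣⇒∣ᵤ {+ d} {i ℤ.+ j} (ℤ∣.∣m∣n⇒∣m+n (ℤ∣.∣ᵤ⇒∣ {+ d} {i} d∣i) (ℤ∣.∣ᵤ⇒∣ {+ d} {j} d∣j))

∣∣-+-cancelʳ : ∀ d {i j} → d ∣ ∣ i ℤ.+ j ∣ → d ∣ ∣ j ∣ → d ∣ ∣ i ∣
∣∣-+-cancelʳ d {i} {j} d∣i+j d∣j =
  ℤ∣.∣⇒∣ᵤ {+ d} {i} (ℤ∣.∣m+n∣n⇒∣m (ℤ∣.∣ᵤ⇒∣ {+ d} {i ℤ.+ j} d∣i+j) (ℤ∣.∣ᵤ⇒∣ {+ d} {j} d∣j))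

◃-*-+ : ∀ s m n → (s ◃ m) ℤ.* + n ≡ s ◃ (m * n)
◃-*-+ s m n = begin
  (s ◃ m) ℤ.* + n                ≡⟨ cong ((s ◃ m) ℤ.*_) (ℤₚ.+◃n≡+n n) ⟨
  (s ◃ m) ℤ.* (Sign.+ ◃ n)       ≡⟨ ℤₚ.◃-distrib-* s Sign.+ m n ⟨
  (s Sign.* Sign.+) ◃ (m * n)    ≡⟨ cong (_◃ (m * n)) (Signₚ.*-identityʳ s) ⟩
  s ◃ (m * n)                    ∎

i+j-j≡i : ∀ i j → i ℤ.+ j ℤ.- j ≡ i
i+j-j≡i = ℤ-Ring.solve-∀

i≡i-j+j : ∀ i j → i ≡ i ℤ.- j ℤ.+ j
i≡i-j+j = ℤ-Ring.solve-∀

≃⇒∣↥∣-cross : ∀ {c m e-1} → toℚᵘ c ≃ mkℚᵘ m e-1 → ∣ ↥ c ∣ * suc e-1 ≡ ∣ m ∣ * ↧ₙ c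
≃⇒∣↥∣-cross {c@(mkℚ n _ _)} {m} {e-1} (*≡* n*e≡m*d) = begin
  ∣ n ∣ * suc e-1        ≡⟨ ℤₚ.abs-* n (+ suc e-1) ⟨
  ∣ n ℤ.* + suc e-1 ∣    ≡⟨ cong ∣_∣ n*e≡m*d ⟩
  ∣ m ℤ.* ↧ c ∣          ≡⟨ ℤₚ.abs-* m (↧ c) ⟩
  ∣ m ∣ * ↧ₙ c           ∎

-- Polynomial coefficients

coeff-⊕ : ∀ P Q k → coeff (P ⊕ Q) k ≡ coeff P k ℚ.+ coeff Q k
coeff-⊕ []       Q        k       = sym (ℚₚ.+-identityˡ (coeff Q k))
coeff-⊕ (a ∷ as) []       k       = sym (ℚₚ.+-identityʳ (coeff (a ∷ as) k))
coeff-⊕ (a ∷ as) (b ∷ bs) zero    = refl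
coeff-⊕ (a ∷ as) (b ∷ bs) (suc k) = coeff-⊕ as bs k

coeff-scale : ∀ c P k → coeff (scale c P) k ≡ c ℚ.* coeff P k
coeff-scale c []       k       = sym (ℚₚ.*-zeroʳ c)
coeff-scale c (a ∷ as) zero    = refl
coeff-scale c (a ∷ as) (suc k) = coeff-scale c as k

coeff-∷⊗ : ∀ a P Q k → coeff ((a ∷ P) ⊗ Q) k ≡ a ℚ.* coeff Q k ℚ.+ coeff (0ℚ ∷ (P ⊗ Q)) k
coeff-∷⊗ a P Q k = trans (coeff-⊕ (scale a Q) (0ℚ ∷ (P ⊗ Q)) k) (cong (ℚ._+ _) (coeff-scale a Q k))

coeff-⊗-0 : ∀ P Q → coeff (P ⊗ Q) 0 ≡ coeff P 0 ℚ.* coeff Q 0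
coeff-⊗-0 []       Q = sym (ℚₚ.*-zeroˡ (coeff Q 0))
coeff-⊗-0 (a ∷ as) Q = trans (coeff-∷⊗ a as Q 0) (ℚₚ.+-identityʳ _)

coeff-compose-0 : ∀ a as g → coeff (compose (a ∷ as) g) 0 ≡ a ℚ.+ coeff g 0 ℚ.* coeff (compose as g) 0
coeff-compose-0 a as g =
  trans (coeff-⊕ (a ∷ []) (g ⊗ compose as g) 0) (cong (a ℚ.+_) (coeff-⊗-0 g (compose as g)))

VanishesFrom : ℕ → Poly → Set
VanishesFrom n h = ∀ j → n ≤ j → coeff h j ≡ 0ℚ

Leading : ℕ → ℚ → Poly → Set
Leading n c h = coeff h n ≡ c × VanishesFrom (suc n) h

singleton-vanishes : ∀ a → VanishesFrom 1 (a ∷ [])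
singleton-vanishes a (suc j) _ = refl

∷-vanishes : ∀ {X} → VanishesFrom 0 X → VanishesFrom 0 (0ℚ ∷ X)
∷-vanishes X≈0 zero    _ = refl
∷-vanishes X≈0 (suc j) _ = X≈0 j z≤n

*-vanishes : ∀ x {Q n} → VanishesFrom n Q → ∀ j → n ≤ j → x ℚ.* coeff Q j ≡ 0ℚ
*-vanishes x {Q} Q≈0 j n≤j = trans (cong (x ℚ.*_) (Q≈0 j n≤j)) (ℚₚ.*-zeroʳ x)

⊗-vanishesʳ : ∀ P Q → VanishesFrom 0 Q → VanishesFrom 0 (P ⊗ Q)
⊗-vanishesʳ []       Q Q≈0 j _ = refl
⊗-vanishesʳ (a ∷ as) Q Q≈0 j _ =
  trans (coeff-∷⊗ a as Q j) (cong₂ ℚ._+_ (*-vanishes a {Q} Q≈0 j z≤n) (∷-vanishes (⊗-vanishesʳ as Q Q≈0) j z≤n))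

⊗-vanishesˡ : ∀ P Q → VanishesFrom 0 P → VanishesFrom 0 (P ⊗ Q)
⊗-vanishesˡ []       Q P≈0 j _ = refl
⊗-vanishesˡ (a ∷ as) Q P≈0 j _ = trans (coeff-∷⊗ a as Q j)
  (cong₂ ℚ._+_ (trans (cong (ℚ._* coeff Q j) (P≈0 0 z≤n)) (ℚₚ.*-zeroˡ (coeff Q j)))
               (∷-vanishes (⊗-vanishesˡ as Q (λ i _ → P≈0 (suc i) z≤n)) j z≤n))

compose-vanishes : ∀ as g → VanishesFrom 0 as → VanishesFrom 0 (compose as g)
compose-vanishes []       g as≈0 j _ = refl
compose-vanishes (a ∷ as) g as≈0 j _ = trans (coeff-⊕ (a ∷ []) (g ⊗ compose as g) j)
  (cong₂ ℚ._+_ (a-vanishes j z≤n) (⊗-vanishesʳ g (compose as g) as∘g≈0 j z≤n))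
  where
    a-vanishes : VanishesFrom 0 (a ∷ [])
    a-vanishes zero    _ = as≈0 0 z≤n
    a-vanishes (suc j) _ = refl
    as∘g≈0 : VanishesFrom 0 (compose as g)
    as∘g≈0 = compose-vanishes as g (λ i _ → as≈0 (suc i) z≤n)

Leading-⊕ˡ : ∀ {n c} U V → Leading n c U → VanishesFrom n V → Leading n c (U ⊕ V)
Leading-⊕ˡ {n} {c} U V (Uₙ≡c , U≈0) V≈0 =
  trans (coeff-⊕ U V n) (trans (cong₂ ℚ._+_ Uₙ≡c (V≈0 n ℕₚ.≤-refl)) (ℚₚ.+-identityʳ c)) ,
  λ j n<j → trans (coeff-⊕ U V j) (cong₂ ℚ._+_ (U≈0 j n<j) (V≈0 j (ℕₚ.<⇒≤ n<j)))

Leading-⊕ʳ : ∀ {n c} U V → VanishesFrom n U → Leading n c V → Leading n c (U ⊕ V)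
Leading-⊕ʳ {n} {c} U V U≈0 (Vₙ≡c , V≈0) =
  trans (coeff-⊕ U V n) (trans (cong₂ ℚ._+_ (U≈0 n ℕₚ.≤-refl) Vₙ≡c) (ℚₚ.+-identityˡ c)) ,
  λ j n<j → trans (coeff-⊕ U V j) (cong₂ ℚ._+_ (U≈0 j (ℕₚ.<⇒≤ n<j)) (V≈0 j n<j))

Leading-⊗ : ∀ {n m a b} P Q → Leading n a P → Leading m b Q → Leading (n + m) (a ℚ.* b) (P ⊗ Q)
Leading-⊗ {n} {m} {a} {b} [] Q (0≡a , _) _ =
  trans (sym (ℚₚ.*-zeroˡ b)) (cong (ℚ._* b) 0≡a) , λ _ _ → refl
Leading-⊗ {zero} {m} {a} {b} (x ∷ xs) Q (x≡a , xs≈0) (Qₘ≡b , Q≈0) =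
  trans (coeff-∷⊗ x xs Q m) (trans (cong₂ ℚ._+_ (cong₂ ℚ._*_ x≡a Qₘ≡b) (rest≈0 m z≤n)) (ℚₚ.+-identityʳ _)) ,
  λ j m<j → trans (coeff-∷⊗ x xs Q j) (cong₂ ℚ._+_ (*-vanishes x {Q} Q≈0 j m<j) (rest≈0 j z≤n))
  where
    rest≈0 : VanishesFrom 0 (0ℚ ∷ (xs ⊗ Q))
    rest≈0 = ∷-vanishes (⊗-vanishesˡ xs Q (λ j _ → xs≈0 (suc j) (s≤s z≤n)))
Leading-⊗ {suc n} {m} {a} {b} (x ∷ xs) Q (xs[n]≡a , xs≈0) (Qₘ≡b , Q≈0) =
  trans (coeff-∷⊗ x xs Q (suc (n + m)))
    (trans (cong₂ ℚ._+_ (*-vanishes x {Q} Q≈0 (suc (n + m)) m<1+n+m) (proj₁ ih)) (ℚₚ.+-identityˡ _)) ,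
  λ { (suc j) (s≤s n+m<j) → trans (coeff-∷⊗ x xs Q (suc j))
        (cong₂ ℚ._+_ (*-vanishes x {Q} Q≈0 (suc j) (ℕₚ.≤-trans m<1+n+m (ℕₚ.m≤n⇒m≤1+n n+m<j))) (proj₂ ih j n+m<j)) }
  where
    ih = Leading-⊗ xs Q (xs[n]≡a , λ j n<j → xs≈0 (suc j) (s≤s n<j)) (Qₘ≡b , Q≈0)
    m<1+n+m : m < suc (n + m)
    m<1+n+m = s≤s (ℕₚ.m≤n+m m n)

Degree-unique : ∀ {f m n} → Degree f m → Degree f n → m ≡ n
Degree-unique {m = m} {n} (fₘ≢0 , f≈0-beyond-m) (fₙ≢0 , f≈0-beyond-n) with ℕₚ.<-cmp m n
... | tri< m<n _ _ = ⊥-elim (fₙ≢0 (f≈0-beyond-m n m<n))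
... | tri≈ _ m≡n _ = m≡n
... | tri> _ _ n<m = ⊥-elim (fₘ≢0 (f≈0-beyond-n m n<m))

rn≤nt+rk⇒r[n∸k]≤tn : ∀ {r n k t} → r * n ≤ n * t + (r * k + 0) → r * (n ∸ k) ≤ t * n
rn≤nt+rk⇒r[n∸k]≤tn {r} {n} {k} {t} rn≤ =
  subst₂ _≤_ (sym (ℕₚ.*-distribˡ-∸ r n k)) (ℕₚ.*-comm n t)
    (ℕₚ.m≤n+o⇒m∸n≤o (r * n) (r * k) (ℕₚ.≤-trans rn≤ (ℕₚ.≤-reflexive (swap (n * t) (r * k)))))
  where
    swap : ∀ x y → x + (y + 0) ≡ y + x
    swap = ℕ-Ring.solve-∀

r[n∸k]≤tn⇒rn≤nt+rk : ∀ {r n k t} → k ≤ n → r * (n ∸ k) ≤ t * n → r * n ≤ n * t + (r * k + 0)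
r[n∸k]≤tn⇒rn≤nt+rk {r} {n} {k} {t} k≤n r[n-k]≤tn =
  subst₂ _≤_ split (regroup t n (r * k)) (ℕₚ.+-monoˡ-≤ (r * k) r[n-k]≤tn)
  where
    split : r * (n ∸ k) + r * k ≡ r * n
    split = trans (sym (ℕₚ.*-distribˡ-+ r (n ∸ k) k)) (cong (r *_) (ℕₚ.m∸n+n≡m k≤n))
    regroup : ∀ t n x → t * n + x ≡ n * t + (x + 0)
    regroup = ℕ-Ring.solve-∀

+*+≰-[1+]*+ : ∀ r a v {n} → 1 ≤ n → ¬ (+ r ℤ.* + a ℤ.≤ -[1+ v ] ℤ.* + n)
+*+≰-[1+]*+ r a v n≥1 ra≤ =
  negative n≥1 (ℤₚ.≤-trans (+≤+ z≤n) (subst (ℤ._≤ _) (sym (ℤₚ.pos-* r a)) ra≤))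
  where
    negative : ∀ {n} → 1 ≤ n → ¬ (+0 ℤ.≤ -[1+ v ] ℤ.* + n)
    negative {suc n} _ ()

-- Multiplicities and p-adic valuations

module _ {p : ℕ} (p-prime : Prime p) where

  private instance
    p-nonZero : NonZero p
    p-nonZero = prime⇒nonZero p-prime
    p-nonTrivial : ℕ.NonTrivial p
    p-nonTrivial = prime⇒nonTrivial p-prime

  p^-nonZero : ∀ k → NonZero (p ^ k)
  p^-nonZero k = ℕₚ.m^n≢0 p k

  p∤1 : ¬ p ∣ 1
  p∤1 p∣1 = ℕ.nonTrivial⇒≢1 (ℕ∣.∣1⇒≡1 p∣1)

  ∤-* : ∀ {m n} → ¬ p ∣ m → ¬ p ∣ n → ¬ p ∣ m * n
  ∤-* {m} {n} p∤m p∤n p∣mn with euclidsLemma m n p-prime p∣mn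
  ... | inj₁ p∣m = p∤m p∣m
  ... | inj₂ p∣n = p∤n p∣n

  ∤⇒IsMult-0 : ∀ {n} → ¬ p ∣ n → IsMult p n 0
  ∤⇒IsMult-0 {n} p∤n = ℕ∣.1∣ n , λ p*1∣n → p∤n (subst (_∣ n) (ℕₚ.*-identityʳ p) p*1∣n)

  IsMult-factor : ∀ {n k} → IsMult p n k → ∃[ m ] n ≡ m * p ^ k × ¬ p ∣ m
  IsMult-factor {n} {k} (divides m n≡m*p^k , p^1+k∤n) = m , n≡m*p^k , p∤m
    where
      p∤m : ¬ p ∣ m
      p∤m p∣m = p^1+k∤n (subst (p * p ^ k ∣_) (sym n≡m*p^k) (ℕ∣.*-monoˡ-∣ (p ^ k) p∣m))

  factor⇒IsMult : ∀ {m} k → ¬ p ∣ m → IsMult p (m * p ^ k) k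
  factor⇒IsMult {m} k p∤m = divides m refl , p^1+k∤m*p^k
    where
      instance _ = p^-nonZero k
      p^1+k∤m*p^k : ¬ p ^ suc k ∣ m * p ^ k
      p^1+k∤m*p^k p*p^k∣m*p^k = p∤m (ℕ∣.*-cancelʳ-∣ (p ^ k) p*p^k∣m*p^k)

  IsMult-* : ∀ {m n i j} → IsMult p m i → IsMult p n j → IsMult p (m * n) (i + j)
  IsMult-* {m} {n} {i} {j} mi nj with IsMult-factor {k = i} mi | IsMult-factor {k = j} nj
  ... | a , refl , p∤a | b , refl , p∤b =
    subst (λ x → IsMult p x (i + j)) (rearrange a b) (factor⇒IsMult (i + j) (∤-* p∤a p∤b))
    where
      rearrange : ∀ a b → a * b * p ^ (i + j) ≡ a * p ^ i * (b * p ^ j)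
      rearrange a b = begin
        a * b * p ^ (i + j)       ≡⟨ cong (a * b *_) (ℕₚ.^-distribˡ-+-* p i j) ⟩
        a * b * (p ^ i * p ^ j)   ≡⟨ interchange a b (p ^ i) (p ^ j) ⟩
        a * p ^ i * (b * p ^ j)   ∎
        where
          interchange : ∀ a b x y → a * b * (x * y) ≡ a * x * (b * y)
          interchange = ℕ-Ring.solve-∀

  IsMult-p : IsMult p p 1
  IsMult-p = subst (λ n → IsMult p n 1) 1*p^1≡p (factor⇒IsMult 1 p∤1)
    where
      1*p^1≡p : 1 * p ^ 1 ≡ p
      1*p^1≡p = trans (ℕₚ.*-identityˡ (p ^ 1)) (ℕₚ.*-identityʳ p)

  multiplicity : ∀ n → .{{NonZero n}} → ∃[ k ] IsMult p n k
  multiplicity n = go (suc n) n ℕₚ.≤-refl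
    where
      go : ∀ fuel n → .{{NonZero n}} → n < fuel → ∃[ k ] IsMult p n k
      go (suc fuel) n n<1+fuel with p ∣? n
      ... | no p∤n = 0 , ∤⇒IsMult-0 p∤n
      ... | yes p∣n@(divides q n≡q*p)
          with go fuel q {{ℕ∣.quotient≢0 p∣n}} (ℕₚ.<-≤-trans (ℕ∣.quotient-< p∣n) (ℕ.s≤s⁻¹ n<1+fuel))
      ...   | k , q-mult =
              k + 1 , subst (λ m → IsMult p m (k + 1)) (sym n≡q*p) (IsMult-* {i = k} {j = 1} q-mult IsMult-p)

  IsMult-+ : ∀ {i j t} → IsMult p ∣ i ∣ t → p ^ suc t ∣ ∣ j ∣ → IsMult p ∣ i ℤ.+ j ∣ t
  IsMult-+ {i} {j} {t} (p^t∣i , p^1+t∤i) p^1+t∣j =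
    ∣∣-+ (p ^ t) {i} {j} p^t∣i (ℕ∣.∣-trans (^-monoʳ-∣ p (ℕₚ.n≤1+n t)) p^1+t∣j) ,
    λ p^1+t∣i+j → p^1+t∤i (∣∣-+-cancelʳ (p ^ suc t) {i} {j} p^1+t∣i+j p^1+t∣j)

  -- c = n / d for some, not necessarily reduced, fraction with P ∣n∣ and p ∤ d. Avoiding reduced
  -- forms keeps ν≥ c t (ν_p(c) ≥ t) and ν≡ c t (ν_p(c) = t) closed under + and * .
  Witnessed : (ℕ → Set) → ℚ → Set
  Witnessed P c = ∃[ q ] toℚᵘ c ≃ q × P ∣ ℚᵘ.↥ q ∣ × ¬ p ∣ ℚᵘ.↧ₙ q

  ν≥ : ℚ → ℕ → Set
  ν≥ c t = Witnessed (p ^ t ∣_) c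

  ν≡ : ℚ → ℕ → Set
  ν≡ c t = Witnessed (λ n → IsMult p n t) c

  witnessed-* : ∀ {P Q R : ℕ → Set} {a b} → (∀ {m n} → P m → Q n → R (m * n)) →
                Witnessed P a → Witnessed Q b → Witnessed R (a ℚ.* b)
  witnessed-* {R = R} {a} {b} PQ⇒R
    (q₁@(mkℚᵘ m₁ _) , a≃q₁ , Pm₁ , p∤d₁) (q₂@(mkℚᵘ m₂ _) , b≃q₂ , Qm₂ , p∤d₂) =
    q₁ ℚᵘ.* q₂ ,
    ℚᵘₚ.≃-trans (ℚₚ.toℚᵘ-homo-* a b) (ℚᵘₚ.*-cong a≃q₁ b≃q₂) ,
    subst R (sym (ℤₚ.abs-* m₁ m₂)) (PQ⇒R Pm₁ Qm₂) ,
    ∤-* p∤d₁ p∤d₂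

  witnessed-+ : ∀ {P Q R : ℕ → Set} {a b} →
                (∀ {m₁ m₂ d₁ d₂} → ¬ p ∣ d₁ → ¬ p ∣ d₂ → P ∣ m₁ ∣ → Q ∣ m₂ ∣ →
                   R ∣ m₁ ℤ.* + d₂ ℤ.+ m₂ ℤ.* + d₁ ∣) →
                Witnessed P a → Witnessed Q b → Witnessed R (a ℚ.+ b)
  witnessed-+ {a = a} {b} PQ⇒R
    (q₁@(mkℚᵘ m₁ _) , a≃q₁ , Pm₁ , p∤d₁) (q₂@(mkℚᵘ m₂ _) , b≃q₂ , Qm₂ , p∤d₂) =
    q₁ ℚᵘ.+ q₂ ,
    ℚᵘₚ.≃-trans (ℚₚ.toℚᵘ-homo-+ a b) (ℚᵘₚ.+-cong a≃q₁ b≃q₂) ,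
    PQ⇒R {m₁} {m₂} {ℚᵘ.↧ₙ q₁} {ℚᵘ.↧ₙ q₂} p∤d₁ p∤d₂ Pm₁ Qm₂ ,
    ∤-* p∤d₁ p∤d₂

  ν≥-0ℚ : ∀ t → ν≥ 0ℚ t
  ν≥-0ℚ t = toℚᵘ 0ℚ , ℚᵘₚ.≃-refl , ℕ∣._∣0 (p ^ t) , p∤1

  ν≡-1ℚ : ν≡ 1ℚ 0
  ν≡-1ℚ = toℚᵘ 1ℚ , ℚᵘₚ.≃-refl , ∤⇒IsMult-0 p∤1 , p∤1

  ν≡⇒ν≥ : ∀ {c t} → ν≡ c t → ν≥ c t
  ν≡⇒ν≥ (q , c≃q , (p^t∣m , _) , p∤d) = q , c≃q , p^t∣m , p∤d

  ν≥-≤ : ∀ {c t u} → u ≤ t → ν≥ c t → ν≥ c u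
  ν≥-≤ u≤t (q , c≃q , p^t∣m , p∤d) = q , c≃q , ℕ∣.∣-trans (^-monoʳ-∣ p u≤t) p^t∣m , p∤d

  ν≥-* : ∀ {a b t u} → ν≥ a t → ν≥ b u → ν≥ (a ℚ.* b) (t + u)
  ν≥-* {t = t} {u} = witnessed-* {p ^ t ∣_} {p ^ u ∣_} {p ^ (t + u) ∣_} λ p^t∣m p^u∣n →
    subst (_∣ _) (sym (ℕₚ.^-distribˡ-+-* p t u)) (ℕ∣.*-pres-∣ {p ^ t} {_} {p ^ u} p^t∣m p^u∣n)

  ν≡-* : ∀ {a b t u} → ν≡ a t → ν≡ b u → ν≡ (a ℚ.* b) (t + u)
  ν≡-* {t = t} {u} =
    witnessed-* {λ n → IsMult p n t} {λ n → IsMult p n u} {λ n → IsMult p n (t + u)} (IsMult-* {i = t} {j = u})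

  ν≥-+ : ∀ {a b t} → ν≥ a t → ν≥ b t → ν≥ (a ℚ.+ b) t
  ν≥-+ {t = t} = witnessed-+ {p ^ t ∣_} {p ^ t ∣_} {p ^ t ∣_}
    λ {m₁} {m₂} {d₁} {d₂} _ _ p^t∣m₁ p^t∣m₂ → ∣∣-+ (p ^ t) {m₁ ℤ.* + d₂} {m₂ ℤ.* + d₁}
      (subst (p ^ t ∣_) (sym (ℤₚ.abs-* m₁ (+ d₂))) (ℕ∣.∣m⇒∣m*n d₂ p^t∣m₁))
      (subst (p ^ t ∣_) (sym (ℤₚ.abs-* m₂ (+ d₁))) (ℕ∣.∣m⇒∣m*n d₁ p^t∣m₂))

  ν≡-+ : ∀ {a b t} → ν≡ a t → ν≥ b (suc t) → ν≡ (a ℚ.+ b) t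
  ν≡-+ {t = t} = witnessed-+ {λ n → IsMult p n t} {p ^ suc t ∣_} {λ n → IsMult p n t}
    λ {m₁} {m₂} {d₁} {d₂} _ p∤d₂ m₁-mult p^1+t∣m₂ → IsMult-+ {m₁ ℤ.* + d₂} {m₂ ℤ.* + d₁} {t}
      (subst₂ (IsMult p) (sym (ℤₚ.abs-* m₁ (+ d₂))) (ℕₚ.+-identityʳ t)
        (IsMult-* {i = t} {j = 0} m₁-mult (∤⇒IsMult-0 p∤d₂)))
      (subst (p ^ suc t ∣_) (sym (ℤₚ.abs-* m₂ (+ d₁))) (ℕ∣.∣m⇒∣m*n d₁ p^1+t∣m₂))

  ν≡⇒≢0 : ∀ {c t} → ν≡ c t → c ≢ 0ℚ
  ν≡⇒≢0 {t = t} (mkℚᵘ m _ , *≡* 0≡m*1 , m-mult , _) refl =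
    ℕ.≢-nonZero⁻¹ ∣ m ∣ {{IsMult⇒nonZero {p} {k = t} m-mult}}
      (cong ∣_∣ (trans (sym (ℤₚ.*-identityʳ m)) (sym 0≡m*1)))

  witness⇒Val : ∀ {c m e-1 j} → toℚᵘ c ≃ mkℚᵘ m e-1 → IsMult p ∣ m ∣ j → ¬ p ∣ suc e-1 → Val p c (+ j)
  witness⇒Val {c} {m} {e-1} {j} c≃q m-mult p∤e with multiplicity (↧ₙ c)
  ... | l , d-mult = k , l , n-mult , d-mult , +j≡k-l
    where
      cross = ≃⇒∣↥∣-cross {c} c≃q
      m*d-mult : IsMult p (∣ m ∣ * ↧ₙ c) (j + l)
      m*d-mult = IsMult-* {i = j} {j = l} m-mult d-mult
      instance
        n≢0 : NonZero ∣ ↥ c ∣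
        n≢0 = ℕₚ.m*n≢0⇒m≢0 ∣ ↥ c ∣
          {{subst NonZero (sym cross) (IsMult⇒nonZero {p} {k = j + l} m*d-mult)}}
      k = proj₁ (multiplicity ∣ ↥ c ∣)
      n-mult = proj₂ (multiplicity ∣ ↥ c ∣)
      k≡j+l : k ≡ j + l
      k≡j+l = trans (sym (ℕₚ.+-identityʳ k))
        (IsMult-unique
          (subst (λ x → IsMult p x (k + 0)) cross (IsMult-* {i = k} {j = 0} n-mult (∤⇒IsMult-0 p∤e)))
          m*d-mult)
      +j≡k-l : + j ≡ + k ℤ.- + l
      +j≡k-l = trans (sym (i+j-j≡i (+ j) (+ l))) (cong (λ x → + x ℤ.- + l) (sym k≡j+l))

  ν≡⇒Val : ∀ {c t} → ν≡ c t → Val p c (+ t)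
  ν≡⇒Val (mkℚᵘ _ _ , c≃q , m-mult , p∤e) = witness⇒Val c≃q m-mult p∤e

  ν≥⇒Val : ∀ {c t} → ν≥ c t → c ≢ 0ℚ → ∃[ u ] t ≤ u × Val p c (+ u)
  ν≥⇒Val {c} {t} (mkℚᵘ m e-1 , c≃q , p^t∣m , p∤e) c≢0 =
    u , IsMult-≤ {p} m-mult p^t∣m , witness⇒Val c≃q m-mult p∤e
    where
      ∣m∣≢0 : ∣ m ∣ ≢ 0
      ∣m∣≢0 ∣m∣≡0 = c≢0 (ℚₚ.↥p≡0⇒p≡0 c (ℤₚ.∣i∣≡0⇒i≡0
        (ℕₚ.m*n≡0⇒m≡0 ∣ ↥ c ∣ (suc e-1) (trans (≃⇒∣↥∣-cross {c} c≃q) (cong (_* ↧ₙ c) ∣m∣≡0)))))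
      u = proj₁ (multiplicity ∣ m ∣ {{ℕ.≢-nonZero ∣m∣≢0}})
      m-mult = proj₂ (multiplicity ∣ m ∣ {{ℕ.≢-nonZero ∣m∣≢0}})

  -- From ∣↥ c∣ = x·pᵏ and ↧ c = y·pˡ with t = k − l, c is the fraction ±x·pᵗ / y.
  Val⇒ν≡ : ∀ {c t} → Val p c (+ t) → ν≡ c t
  Val⇒ν≡ {c@(mkℚ n d-1 _)} {t} (k , l , n-mult , d-mult , +t≡k-l)
    with IsMult-factor {k = k} n-mult | IsMult-factor {k = l} d-mult
  ... | _ | zero , () , _
  ... | x , ∣n∣≡x*p^k , p∤x | suc y-1 , d≡y*p^l , p∤y =
    mkℚᵘ (sign n ◃ (x * p ^ t)) y-1 , *≡* cross ,
    subst (λ z → IsMult p z t) (sym (ℤₚ.abs-◃ (sign n) (x * p ^ t))) (factor⇒IsMult t p∤x) , p∤y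
    where
      k≡t+l : k ≡ t + l
      k≡t+l = ℤₚ.+-injective (trans (i≡i-j+j (+ k) (+ l)) (cong (ℤ._+ + l) (sym +t≡k-l)))
      ∣n∣*y≡x*p^t*d : ∣ n ∣ * suc y-1 ≡ x * p ^ t * suc d-1
      ∣n∣*y≡x*p^t*d = begin
        ∣ n ∣ * suc y-1                 ≡⟨ cong (_* suc y-1) ∣n∣≡x*p^k ⟩
        x * p ^ k * suc y-1             ≡⟨ cong (λ e → x * p ^ e * suc y-1) k≡t+l ⟩
        x * p ^ (t + l) * suc y-1       ≡⟨ cong (λ z → x * z * suc y-1) (ℕₚ.^-distribˡ-+-* p t l) ⟩
        x * (p ^ t * p ^ l) * suc y-1   ≡⟨ regroup x (p ^ t) (p ^ l) (suc y-1) ⟩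
        x * p ^ t * (suc y-1 * p ^ l)   ≡⟨ cong (x * p ^ t *_) d≡y*p^l ⟨
        x * p ^ t * suc d-1             ∎
        where
          regroup : ∀ x a b y → x * (a * b) * y ≡ x * a * (y * b)
          regroup = ℕ-Ring.solve-∀
      cross : n ℤ.* + suc y-1 ≡ (sign n ◃ (x * p ^ t)) ℤ.* + suc d-1
      cross = begin
        n ℤ.* + suc y-1                      ≡⟨ cong (ℤ._* + suc y-1) (ℤₚ.◃-inverse n) ⟨
        (sign n ◃ ∣ n ∣) ℤ.* + suc y-1        ≡⟨ ◃-*-+ (sign n) ∣ n ∣ (suc y-1) ⟩
        sign n ◃ (∣ n ∣ * suc y-1)            ≡⟨ cong (sign n ◃_) ∣n∣*y≡x*p^t*d ⟩
        sign n ◃ (x * p ^ t * suc d-1)        ≡⟨ ◃-*-+ (sign n) (x * p ^ t) (suc d-1) ⟨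
        (sign n ◃ (x * p ^ t)) ℤ.* + suc d-1  ∎

  -- Newton polygon bounds

  record BoundedBy (A C e : ℕ) (a : ℚ) : Set where
    constructor bounded
    field
      exponent : ℕ
      ν≥exponent : ν≥ a exponent
      weighted : C ≤ A * exponent + e

  BoundedBy-0ℚ : ∀ {A C e} → .{{NonZero A}} → BoundedBy A C e 0ℚ
  BoundedBy-0ℚ {A} {C} {e} = bounded C (ν≥-0ℚ C) (ℕₚ.≤-trans (ℕₚ.m≤n*m C A) (ℕₚ.m≤m+n (A * C) e))

  BoundedBy-≤ : ∀ {A C C′ e e′ a} → C′ ≤ C → e ≤ e′ → BoundedBy A C e a → BoundedBy A C′ e′ a
  BoundedBy-≤ {A} C′≤C e≤e′ (bounded t a≥t C≤) =
    bounded t a≥t (ℕₚ.≤-trans C′≤C (ℕₚ.≤-trans C≤ (ℕₚ.+-monoʳ-≤ (A * t) e≤e′)))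

  BoundedBy-cong : ∀ {A C e e′ a} → e ≡ e′ → BoundedBy A C e a → BoundedBy A C e′ a
  BoundedBy-cong e≡e′ = BoundedBy-≤ ℕₚ.≤-refl (ℕₚ.≤-reflexive e≡e′)

  BoundedBy-cancel : ∀ {A C D e a} → BoundedBy A (D + C) (D + e) a → BoundedBy A C e a
  BoundedBy-cancel {A} {C} {D} {e} (bounded t a≥t D+C≤) =
    bounded t a≥t (ℕₚ.+-cancelˡ-≤ D C (A * t + e) (ℕₚ.≤-trans D+C≤ (ℕₚ.≤-reflexive (swap (A * t) D e))))
    where
      swap : ∀ x y z → x + (y + z) ≡ y + (x + z)
      swap = ℕ-Ring.solve-∀

  BoundedBy-+ : ∀ {A C e a b} → BoundedBy A C e a → BoundedBy A C e b → BoundedBy A C e (a ℚ.+ b)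
  BoundedBy-+ (bounded t a≥t C≤At) (bounded u b≥u C≤Au) with ℕₚ.≤-total t u
  ... | inj₁ t≤u = bounded t (ν≥-+ {t = t} a≥t (ν≥-≤ {t = u} t≤u b≥u)) C≤At
  ... | inj₂ u≤t = bounded u (ν≥-+ {t = u} (ν≥-≤ {t = t} u≤t a≥t) b≥u) C≤Au

  BoundedBy-* : ∀ {A C₁ C₂ e₁ e₂ a b} → BoundedBy A C₁ e₁ a → BoundedBy A C₂ e₂ b →
                BoundedBy A (C₁ + C₂) (e₁ + e₂) (a ℚ.* b)
  BoundedBy-* {A} {e₁ = e₁} {e₂} (bounded t a≥t C₁≤) (bounded u b≥u C₂≤) =
    bounded (t + u) (ν≥-* {t = t} {u} a≥t b≥u)
      (ℕₚ.≤-trans (ℕₚ.+-mono-≤ C₁≤ C₂≤) (ℕₚ.≤-reflexive (regroup A t u e₁ e₂)))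
    where
      regroup : ∀ A t u e₁ e₂ → A * t + e₁ + (A * u + e₂) ≡ A * (t + u) + (e₁ + e₂)
      regroup = ℕ-Ring.solve-∀

  -- The points (k, ν_p(aₖ)) of h lie on or above the line A·y + B·x + E = C.
  record Above (A B C E : ℕ) (h : Poly) : Set where
    constructor above
    field
      coeff-bound : ∀ k → BoundedBy A C (B * k + E) (coeff h k)
  open Above public

  module _ {A B : ℕ} .{{_ : NonZero A}} where

    Above-[] : ∀ {C E} → Above A B C E []
    Above-[] = above λ _ → BoundedBy-0ℚ

    Above-tail : ∀ {C E a as} → Above A B C E (a ∷ as) → Above A B C (B + E) as
    Above-tail {E = E} as-above = above λ k → BoundedBy-cong (shift B k E) (coeff-bound as-above (suc k))
      where
        shift : ∀ B k E → B * suc k + E ≡ B * k + (B + E)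
        shift = ℕ-Ring.solve-∀

    Above-0∷ : ∀ {C E X} → Above A B C (B + E) X → Above A B C E (0ℚ ∷ X)
    Above-0∷ {E = E} X-above = above λ
      { zero    → BoundedBy-0ℚ
      ; (suc k) → BoundedBy-cong (unshift B k E) (coeff-bound X-above k) }
      where
        unshift : ∀ B k E → B * k + (B + E) ≡ B * suc k + E
        unshift = ℕ-Ring.solve-∀

    Above-cancel : ∀ {C D E h} → Above A B (D + C) (D + E) h → Above A B C E h
    Above-cancel {D = D} {E} h-above = above λ k →
      BoundedBy-cancel (BoundedBy-cong (swap (B * k) D E) (coeff-bound h-above k))
      where
        swap : ∀ x y z → x + (y + z) ≡ y + (x + z)
        swap = ℕ-Ring.solve-∀

    Above-⊕ : ∀ {C E} P Q → Above A B C E P → Above A B C E Q → Above A B C E (P ⊕ Q)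
    Above-⊕ P Q P-above Q-above = above λ k →
      subst (BoundedBy A _ _) (sym (coeff-⊕ P Q k))
        (BoundedBy-+ (coeff-bound P-above k) (coeff-bound Q-above k))

    Above-scale : ∀ {C₁ C₂ E₁ E₂ a} Q → BoundedBy A C₁ E₁ a → Above A B C₂ E₂ Q →
                  Above A B (C₁ + C₂) (E₁ + E₂) (scale a Q)
    Above-scale {E₁ = E₁} {E₂} {a} Q a-bound Q-above = above λ k →
      subst (BoundedBy A _ _) (sym (coeff-scale a Q k))
        (BoundedBy-cong (swap E₁ (B * k) E₂) (BoundedBy-* a-bound (coeff-bound Q-above k)))
      where
        swap : ∀ x y z → x + (y + z) ≡ y + (x + z)
        swap = ℕ-Ring.solve-∀

    Above-⊗ : ∀ {C₁ C₂ E₁ E₂} P Q → Above A B C₁ E₁ P → Above A B C₂ E₂ Q →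
              Above A B (C₁ + C₂) (E₁ + E₂) (P ⊗ Q)
    Above-⊗ []       Q P-above Q-above = Above-[]
    Above-⊗ {C₁} {C₂} {E₁} {E₂} (a ∷ as) Q P-above Q-above =
      Above-⊕ (scale a Q) (0ℚ ∷ (as ⊗ Q))
        (Above-scale Q (BoundedBy-cong (cong (_+ E₁) (ℕₚ.*-zeroʳ B)) (coeff-bound P-above 0)) Q-above)
        (Above-0∷ (subst (λ E → Above A B (C₁ + C₂) E (as ⊗ Q)) (ℕₚ.+-assoc B E₁ E₂)
          (Above-⊗ as Q (Above-tail P-above) Q-above)))

  -- gⁱ lies above the line with intercept i·Cg, so in Horner's scheme a coefficient aᵢ of `as`
  -- only needs A·ν_p(aᵢ) + Cg·i + E ≥ C.
  Above-compose : ∀ {A B Cg C g} → .{{NonZero A}} →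
                  Above A B Cg 0 g → ∀ E as → Above A Cg C E as → Above A B C E (compose as g)
  Above-compose g-above E []       _        = Above-[]
  Above-compose {A} {B} {Cg} {C} {g} g-above E (a ∷ as) as-above =
    Above-⊕ (a ∷ []) (g ⊗ compose as g) a-above
      (Above-cancel (Above-⊗ g (compose as g) g-above
        (Above-compose g-above (Cg + E) as (Above-tail as-above))))
    where
      a-above : Above A B C E (a ∷ [])
      a-above = above λ
        { zero    → BoundedBy-cong (cong (_+ E) (trans (ℕₚ.*-zeroʳ Cg) (sym (ℕₚ.*-zeroʳ B))))
                        (coeff-bound as-above 0)
        ; (suc k) → BoundedBy-0ℚ }

  BoundedBy-monoˡ : ∀ {A A′ C e a} → A ≤ A′ → BoundedBy A C e a → BoundedBy A′ C e a
  BoundedBy-monoˡ {e = e} A≤A′ (bounded t a≥t C≤) =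
    bounded t a≥t (ℕₚ.≤-trans C≤ (ℕₚ.+-monoˡ-≤ e (ℕₚ.*-monoˡ-≤ t A≤A′)))

  BoundedBy-*ℕ : ∀ {A C e a} m → BoundedBy A C e a → BoundedBy (m * A) (m * C) (m * e) a
  BoundedBy-*ℕ {A} {e = e} m (bounded t a≥t C≤) =
    bounded t a≥t (ℕₚ.≤-trans (ℕₚ.*-monoʳ-≤ m C≤) (ℕₚ.≤-reflexive (distrib m A t e)))
    where
      distrib : ∀ m A t e → m * (A * t + e) ≡ m * A * t + m * e
      distrib = ℕ-Ring.solve-∀

  Above-monoˡ : ∀ {A A′ B C E h} → A ≤ A′ → Above A B C E h → Above A′ B C E h
  Above-monoˡ A≤A′ h-above = above λ k → BoundedBy-monoˡ A≤A′ (coeff-bound h-above k)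

  Above-*ℕ : ∀ {A B C E h} m → Above A B C E h → Above (m * A) (m * B) (m * C) (m * E) h
  Above-*ℕ {B = B} {E = E} m h-above = above λ k →
    BoundedBy-cong (distrib m B k E) (BoundedBy-*ℕ m (coeff-bound h-above k))
    where
      distrib : ∀ m B k E → m * (B * k + E) ≡ m * B * k + m * E
      distrib = ℕ-Ring.solve-∀

  Above-cong : ∀ {A A′ B B′ C C′ E E′ h} → A ≡ A′ → B ≡ B′ → C ≡ C′ → E ≡ E′ →
               Above A B C E h → Above A′ B′ C′ E′ h
  Above-cong refl refl refl refl h-above = h-above

  compose-leading : ∀ {m b g} → Leading m b g → ν≡ b 0 → 1 ≤ m →
                    ∀ j as {a} → Leading j a as → ν≡ a 0 → ∃[ c ] ν≡ c 0 × Leading (j * m) c (compose as g)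
  compose-leading g-lead b-unit m≥1 j [] (0≡a , _) a-unit = ⊥-elim (ν≡⇒≢0 {t = 0} a-unit (sym 0≡a))
  compose-leading {g = g} g-lead b-unit m≥1 zero (x ∷ xs) {a} (x≡a , xs≈0) a-unit =
    a , a-unit , Leading-⊕ˡ (x ∷ []) (g ⊗ compose xs g) (x≡a , singleton-vanishes x)
      (λ i _ → ⊗-vanishesʳ g (compose xs g) (compose-vanishes xs g λ i _ → xs≈0 (suc i) (s≤s z≤n)) i z≤n)
  compose-leading {m} {b} {g} g-lead b-unit m≥1 (suc j) (x ∷ xs) (xs[j]≡a , xs≈0) a-unit
    with compose-leading g-lead b-unit m≥1 j xs (xs[j]≡a , λ i j<i → xs≈0 (suc i) (s≤s j<i)) a-unit
  ... | c , c-unit , c-lead =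
    b ℚ.* c , ν≡-* {t = 0} {u = 0} b-unit c-unit ,
    Leading-⊕ʳ (x ∷ []) (g ⊗ compose xs g)
      (λ i m+jm≤i → singleton-vanishes x i (ℕₚ.≤-trans m≥1 (ℕₚ.≤-trans (ℕₚ.m≤m+n m (j * m)) m+jm≤i)))
      (Leading-⊗ g (compose xs g) g-lead c-lead)

  -- Composition and iterates

  -- p^r-purity without ν_p(a₀) = r, which fails for x = f⁰.
  record WeaklyPure (r : ℕ) (h : Poly) : Set where
    field
      deg       : ℕ
      deg≥1     : 1 ≤ deg
      lead      : ℚ
      leading   : Leading deg lead h
      lead-unit : ν≡ lead 0
      newton    : Above deg r (r * deg) 0 h

  module Composition {r f g} (F : WeaklyPure r f) (G : WeaklyPure r g) where
    open WeaklyPure F using () renaming (deg to d; deg≥1 to d≥1)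
    open WeaklyPure G using () renaming (deg to m; deg≥1 to m≥1)

    private instance
      d≢0 : NonZero d
      d≢0 = ℕ.>-nonZero d≥1
      dm≢0 : NonZero (d * m)
      dm≢0 = ℕ.>-nonZero (ℕₚ.*-mono-≤ d≥1 m≥1)

    -- Measured with weight d·m, g lies above a line of intercept r·m: exactly what f's bound,
    -- scaled by m, charges per power of g.
    g-above : Above (d * m) r (r * m) 0 g
    g-above = Above-monoˡ (ℕₚ.m≤n*m m d) (WeaklyPure.newton G)

    f-above : Above (d * m) (r * m) (r * m * d) 0 f
    f-above = Above-cong (ℕₚ.*-comm m d) (ℕₚ.*-comm m r) (regroup m r d) (ℕₚ.*-zeroʳ m)
                (Above-*ℕ m (WeaklyPure.newton F))
      where
        regroup : ∀ m r d → m * (r * d) ≡ r * m * d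
        regroup = ℕ-Ring.solve-∀

    weaklyPure : WeaklyPure r (compose f g)
    weaklyPure = record
      { deg       = d * m
      ; deg≥1     = ℕₚ.*-mono-≤ d≥1 m≥1
      ; lead      = proj₁ leading
      ; leading   = proj₂ (proj₂ leading)
      ; lead-unit = proj₁ (proj₂ leading)
      ; newton    = Above-cong refl refl (regroup r m d) refl (Above-compose g-above 0 f f-above)
      }
      where
        leading : ∃[ c ] ν≡ c 0 × Leading (d * m) c (compose f g)
        leading = compose-leading (WeaklyPure.leading G) (WeaklyPure.lead-unit G) m≥1
                    d f (WeaklyPure.leading F) (WeaklyPure.lead-unit F)
        regroup : ∀ r m d → r * m * d ≡ r * (d * m)
        regroup = ℕ-Ring.solve-∀

    constant-exact : 1 ≤ r → 2 ≤ d → ν≡ (coeff f 0) r → ν≡ (coeff (compose f g) 0) r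
    constant-exact r≥1 d≥2 = exact f f-above
      where
        instance
          m≢0 : NonZero m
          m≢0 = ℕ.>-nonZero m≥1
          rm≢0 : NonZero (r * m)
          rm≢0 = ℕ.>-nonZero (ℕₚ.*-mono-≤ r≥1 m≥1)

        g₀≥r : ν≥ (coeff g 0) r
        g₀≥r with coeff-bound (WeaklyPure.newton G) 0
        ... | bounded t g₀≥t rm≤mt+0 = ν≥-≤ {t = t} (ℕₚ.*-cancelˡ-≤ m mr≤mt) g₀≥t
          where
            drop-zeros : ∀ m t r → m * t + (r * 0 + 0) ≡ m * t
            drop-zeros = ℕ-Ring.solve-∀
            mr≤mt : m * r ≤ m * t
            mr≤mt = subst₂ _≤_ (ℕₚ.*-comm r m) (drop-zeros m t r) rm≤mt+0

        exact : ∀ as → Above (d * m) (r * m) (r * m * d) 0 as →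
                ν≡ (coeff as 0) r → ν≡ (coeff (compose as g) 0) r
        exact []       _         0-exact = ⊥-elim (ν≡⇒≢0 {t = r} 0-exact refl)
        exact (a ∷ as) a∷as-above a-exact =
          subst (λ c → ν≡ c r) (sym (coeff-compose-0 a as g))
            (ν≡-+ {t = r} a-exact (subst (ν≥ _) (ℕₚ.+-comm r 1) (ν≥-* {t = r} {u = 1} g₀≥r tail₀≥1)))
          where
            tail₀≥1 : ν≥ (coeff (compose as g) 0) 1
            tail₀≥1 with coeff-bound (Above-compose g-above (r * m + 0) as (Above-tail a∷as-above)) 0
            ... | bounded (suc t) tail₀≥1+t _ = ν≥-≤ {t = suc t} (s≤s z≤n) tail₀≥1+t
            ... | bounded zero    _ rmd≤dm0+rm =
                    ⊥-elim (ℕₚ.n≮n (r * m) (ℕₚ.<-≤-trans (ℕₚ.m<m*n (r * m) d d≥2) rmd≤rm))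
              where
                drop-zeros : ∀ d m r → d * m * 0 + (r * 0 + (r * m + 0)) ≡ r * m
                drop-zeros = ℕ-Ring.solve-∀
                rmd≤rm : r * m * d ≤ r * m
                rmd≤rm = subst (r * m * d ≤_) (drop-zeros d m r) rmd≤dm0+rm

  weaklyPure-x : ∀ {r} → WeaklyPure r (0ℚ ∷ 1ℚ ∷ [])
  weaklyPure-x {r} = record
    { deg = 1 ; deg≥1 = ℕₚ.≤-refl ; lead = 1ℚ ; leading = refl , beyond ; lead-unit = ν≡-1ℚ
    ; newton = above λ
        { zero          → bounded r (ν≥-0ℚ r) (ℕₚ.≤-reflexive (constant-line r))
        ; (suc zero)    → bounded 0 (ν≡⇒ν≥ {1ℚ} {0} ν≡-1ℚ) (ℕₚ.≤-reflexive (linear-line r))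
        ; (suc (suc k)) → BoundedBy-0ℚ } }
    where
      beyond : VanishesFrom 2 (0ℚ ∷ 1ℚ ∷ [])
      beyond (suc zero)    (s≤s ())
      beyond (suc (suc j)) _ = refl
      constant-line : ∀ r → r * 1 ≡ 1 * r + (r * 0 + 0)
      constant-line = ℕ-Ring.solve-∀
      linear-line : ∀ r → r * 1 ≡ 1 * 0 + (r * 1 + 0)
      linear-line = ℕ-Ring.solve-∀

  weaklyPure-iterate : ∀ {r f} → WeaklyPure r f → ∀ n → WeaklyPure r (iterate f n)
  weaklyPure-iterate F zero    = weaklyPure-x
  weaklyPure-iterate F (suc n) = Composition.weaklyPure F (weaklyPure-iterate F n)

  Pure⇒WeaklyPure : ∀ {r f} (P : Pure p r f) → 1 ≤ proj₁ P → WeaklyPure r f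
  Pure⇒WeaklyPure {r} {f} (n , (_ , beyond) , lead-val , const-val , mid) n≥1 = record
    { deg = n ; deg≥1 = n≥1 ; lead = coeff f n ; leading = refl , beyond
    ; lead-unit = Val⇒ν≡ lead-val ; newton = above bound }
    where
      instance
        n≢0 : NonZero n
        n≢0 = ℕ.>-nonZero n≥1
      bound : ∀ k → BoundedBy n (r * n) (r * k + 0) (coeff f k)
      bound zero = bounded r (ν≡⇒ν≥ {t = r} (Val⇒ν≡ const-val)) (ℕₚ.≤-reflexive (constant-line r n))
        where
          constant-line : ∀ r n → r * n ≡ n * r + (r * 0 + 0)
          constant-line = ℕ-Ring.solve-∀
      bound (suc k) with ℕₚ.<-cmp (suc k) n
      ... | tri≈ _ refl _ =
              bounded 0 (ν≡⇒ν≥ {t = 0} (Val⇒ν≡ lead-val)) (ℕₚ.≤-reflexive (leading-line r (suc k)))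
        where
          leading-line : ∀ r n → r * n ≡ n * 0 + (r * n + 0)
          leading-line = ℕ-Ring.solve-∀
      ... | tri> _ _ n<k = subst (BoundedBy n _ _) (sym (beyond (suc k) n<k)) BoundedBy-0ℚ
      ... | tri< k<n _ _ with mid (suc k) (s≤s z≤n) k<n
      ...   | inj₁ fₖ≡0 = subst (BoundedBy n _ _) (sym fₖ≡0) BoundedBy-0ℚ
      ...   | inj₂ (+ t , val , r[n-k]≤tn) =
              bounded t (ν≡⇒ν≥ {t = t} (Val⇒ν≡ val))
                (r[n∸k]≤tn⇒rn≤nt+rk {r} {n} {suc k} {t} (ℕₚ.<⇒≤ k<n)
                  (ℤₚ.drop‿+≤+ (subst₂ ℤ._≤_ (sym (ℤₚ.pos-* r (n ∸ suc k))) (sym (ℤₚ.pos-* t n)) r[n-k]≤tn)))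
      ...   | inj₂ (-[1+ v ] , _ , r[n-k]≤vn) = ⊥-elim (+*+≰-[1+]*+ r (n ∸ suc k) v n≥1 r[n-k]≤vn)

  WeaklyPure⇒Pure : ∀ {r h} → WeaklyPure r h → ν≡ (coeff h 0) r → Pure p r h
  WeaklyPure⇒Pure {r} {h} H h₀-exact =
    deg , (lead≢0 , proj₂ leading) , lead-val , ν≡⇒Val h₀-exact , middle
    where
      open WeaklyPure H
      lead≢0 : coeff h deg ≢ 0ℚ
      lead≢0 hₙ≡0 = ν≡⇒≢0 {t = 0} lead-unit (trans (sym (proj₁ leading)) hₙ≡0)
      lead-val : Val p (coeff h deg) (+ 0)
      lead-val = subst (λ c → Val p c (+ 0)) (sym (proj₁ leading)) (ν≡⇒Val lead-unit)
      middle : ∀ i → 1 ≤ i → i < deg → coeff h i ≡ 0ℚ ⊎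
               ∃[ v ] (Val p (coeff h i) v × (+ r) ℤ.* (+ (deg ∸ i)) ℤ.≤ v ℤ.* (+ deg))
      middle i _ _ with coeff h i ℚₚ.≟ 0ℚ
      ... | yes hᵢ≡0 = inj₁ hᵢ≡0
      ... | no  hᵢ≢0 with coeff-bound newton i
      ...   | bounded t hᵢ≥t weighted with ν≥⇒Val {t = t} hᵢ≥t hᵢ≢0
      ...     | u , t≤u , val = inj₂ (+ u , val ,
                subst₂ ℤ._≤_ (ℤₚ.pos-* r (deg ∸ i)) (ℤₚ.pos-* u deg)
                  (+≤+ (rn≤nt+rk⇒r[n∸k]≤tn {r} {deg} {i} {u}
                    (ℕₚ.≤-trans weighted (ℕₚ.+-monoˡ-≤ _ (ℕₚ.*-monoʳ-≤ deg t≤u))))))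

corollary3p11 : (p r : ℕ) → Prime p → 1 ≤ r → (f : Poly) → (d : ℕ) → Degree f d → 1 < d →
    Pure p r f → (n : ℕ) → 1 ≤ n → Pure p r (iterate f n)
corollary3p11 p r p-prime r≥1 f d deg-d 1<d pure@(n , deg-n , _ , a₀-val , _) (suc k) _ =
  WeaklyPure⇒Pure p-prime (Composition.weaklyPure p-prime F Fᵏ)
    (Composition.constant-exact p-prime F Fᵏ r≥1 1<n (Val⇒ν≡ p-prime a₀-val))
  where
    1<n : 1 < n
    1<n = subst (1 <_) (Degree-unique {f} deg-d deg-n) 1<d
    F : WeaklyPure p-prime r f
    F = Pure⇒WeaklyPure p-prime pure (ℕₚ.<⇒≤ 1<n)
    Fᵏ : WeaklyPure p-prime r (iterate f k)
    Fᵏ = weaklyPure-iterate p-prime F k
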